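{- Let $n\geq 1$ and let $C\subseteq\{0,1\}^n$ be a code in the binary $n$-dimensional hypercube such that $|I_C(\mathbf{c})|\geq 3$ for every $\mathbf{c}\in C$ and $|I_C(\mathbf{x})|\geq 1$ for every $\mathbf{x}\in\{0,1\}^n\setminus C$. Then $C$ is a local identifying code.
   Context: The binary $n$-dimensional hypercube is the graph with vertex set $\{0,1\}^n$ in which two binary words are adjacent iff their Hamming distance is $1$. For a vertex $u$, $N[u]$ is its closed neighbourhood, and for a code (nonempty vertex subset) $C$, $I_C(u)=N[u]\cap C$. A code $C$ is a covering code if $I_C(u)\neq\emptyset$ for every vertex $u$. A code $C$ is a local identifying code if it is a covering code and $I_C(u)\neq I_C(v)$ for every pair of adjacent vertices $u,v$. -}

module Defs where

open import Data.Nat using (ℕ; zero; suc; _+_; _≤_)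
open import Data.Bool using (Bool; true; false; _∧_; _xor_; if_then_else_; T)
open import Data.Vec using (Vec; []; _∷_)
open import Data.List using (List; []; _∷_; map; _++_; length; filter)
open import Data.Product using (Σ; _×_; ∃)
open import Relation.Nullary using (¬_)
open import Relation.Unary using (Pred)
open import Function.Bundles using (_⇔_)
open import Relation.Binary.PropositionalEquality using (_≡_)
import Data.Nat.Properties as ℕP
open import Relation.Nullary.Decidable using (Dec; yes; no; _×-dec_)
open import Data.Bool.Properties using (T?)

Word : ℕ → Set
Word n = Vec Bool n

hamming : ∀ {n} → Word n → Word n → ℕ
hamming [] [] = 0
hamming (a ∷ u) (b ∷ v) = (if a xor b then 1 else 0) + hamming u v

allWords : (n : ℕ) → List (Word n)
allWords zero = [] ∷ []
allWords (suc n) = map (false ∷_) (allWords n) ++ map (true ∷_) (allWords n)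

Code : ℕ → Set
Code n = Word n → Bool

Nonempty : ∀ {n} → Code n → Set
Nonempty {n} C = Σ (Word n) (λ c → T (C c))

Adjacent : ∀ {n} → Word n → Word n → Set
Adjacent u v = hamming u v ≡ 1

InClosedNbhd : ∀ {n} → Word n → Word n → Set
InClosedNbhd u w = hamming u w ≤ 1

InI : ∀ {n} → Code n → Word n → Word n → Set
InI C u w = InClosedNbhd u w × T (C w)

inI? : ∀ {n} (C : Code n) (u w : Word n) → Dec (InI C u w)
inI? C u w = (hamming u w ℕP.≤? 1) ×-dec T? (C w)

cardI : ∀ {n} → Code n → Word n → ℕ
cardI {n} C u = length (filter (inI? C u) (allWords n))

IsCovering : ∀ {n} → Code n → Set
IsCovering {n} C = (u : Word n) → Σ (Word n) (λ w → InI C u w)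

SameI : ∀ {n} → Code n → Word n → Word n → Set
SameI {n} C u v = (w : Word n) → InI C u w ⇔ InI C v w

IsLocalIdentifying : ∀ {n} → Code n → Set
IsLocalIdentifying {n} C =
  IsCovering C × ((u v : Word n) → Adjacent u v → ¬ SameI C u v)

{-# OPTIONS --safe #-}
module Submission where

open import Defs
open import Data.Nat using (ℕ; suc; _≤_; _+_; z≤n; s≤s)
open import Data.Nat.Properties using (≤-reflexive; suc-injective; ≤⇒≯)
open import Data.Bool using (Bool; true; false; T; not; if_then_else_)
open import Data.Bool.Properties using (xor-comm; T?)
open import Data.Vec using (_∷_; [])
open import Data.Vec.Properties using (∷-injectiveʳ)
open import Data.List using ([]; _∷_; map; length; filter)
open import Data.List.Relation.Unary.All as All using (All; []; _∷_)
open import Data.List.Relation.Unary.All.Properties using (all-filter)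
open import Data.List.Relation.Unary.AllPairs using ([]; _∷_)
open import Data.List.Relation.Unary.Unique.Propositional using (Unique)
import Data.List.Relation.Unary.Unique.Propositional.Properties as Unique
open import Data.List.Membership.Propositional using (_∈_)
open import Data.List.Membership.Propositional.Properties using (∈-map⁻)
open import Data.Product using (Σ; _,_; proj₁; proj₂; uncurry)
open import Data.Sum as Sum using (_⊎_; inj₁; inj₂)
open import Data.Empty using (⊥-elim)
open import Relation.Nullary using (¬_; yes; no)
open import Relation.Binary.PropositionalEquality using (_≡_; _≢_; refl; sym; trans; cong; cong₂)
open import Function.Bundles using (Equivalence)
import Function.Properties.Equivalence as ⇔

-- For adjacent u and v the closed neighbourhoods N[u] and N[v] meet only in {u, v}, so
-- I_C(u) = I_C(v) forces I_C(u) ⊆ {u, v} ∩ C, and likewise for v. Then |I_C(u)|, |I_C(v)| ≤ 2,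
-- so neither u nor v lies in C; hence I_C(u) = ∅, contradicting that C covers u.

hamming-refl : ∀ {n} (u : Word n) → hamming u u ≡ 0
hamming-refl []          = refl
hamming-refl (false ∷ u) = hamming-refl u
hamming-refl (true ∷ u)  = hamming-refl u

hamming-sym : ∀ {n} (u v : Word n) → hamming u v ≡ hamming v u
hamming-sym []      []      = refl
hamming-sym (a ∷ u) (b ∷ v) =
  cong₂ _+_ (cong (λ x → if x then 1 else 0) (xor-comm a b)) (hamming-sym u v)

hamming≤0⇒≡ : ∀ {n} {u v : Word n} → hamming u v ≤ 0 → u ≡ v
hamming≤0⇒≡ {u = []}        {[]}        _   = refl
hamming≤0⇒≡ {u = false ∷ u} {false ∷ v} u≈v = cong (false ∷_) (hamming≤0⇒≡ u≈v)
hamming≤0⇒≡ {u = true ∷ u}  {true ∷ v}  u≈v = cong (true ∷_) (hamming≤0⇒≡ u≈v)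
hamming≤0⇒≡ {u = false ∷ u} {true ∷ v}  ()
hamming≤0⇒≡ {u = true ∷ u}  {false ∷ v} ()

hamming≡0⇒≡ : ∀ {n} {u v : Word n} → hamming u v ≡ 0 → u ≡ v
hamming≡0⇒≡ u≈v = hamming≤0⇒≡ (≤-reflexive u≈v)

closedNbhd-refl : ∀ {n} (u : Word n) → InClosedNbhd u u
closedNbhd-refl u rewrite hamming-refl u = z≤n

adjacent-sym : ∀ {n} {u v : Word n} → Adjacent u v → Adjacent v u
adjacent-sym {u = u} {v} u~v = trans (hamming-sym v u) u~v

adjacent⇒≢ : ∀ {n} {u v : Word n} → Adjacent u v → u ≢ v
adjacent⇒≢ {u = u} u~u refl with () ← trans (sym (hamming-refl u)) u~u

adjacent-closedNbhd-∩ : ∀ {n} {u v w : Word n} → Adjacent u v →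
  InClosedNbhd u w → InClosedNbhd v w → w ≡ u ⊎ w ≡ v
adjacent-closedNbhd-∩ {u = []} {[]} {[]} () _ _
-- Either the leading bits of u and v agree (and w shares them, or u ≡ w ≡ v), or they
-- differ, the tails of u and v coincide, and the tail of w must coincide with them too.
adjacent-closedNbhd-∩ {u = false ∷ u} {false ∷ v} {false ∷ w} u~v uw vw =
  Sum.map (cong (false ∷_)) (cong (false ∷_)) (adjacent-closedNbhd-∩ {u = u} {v} {w} u~v uw vw)
adjacent-closedNbhd-∩ {u = true ∷ u}  {true ∷ v}  {true ∷ w}  u~v uw vw =
  Sum.map (cong (true ∷_)) (cong (true ∷_)) (adjacent-closedNbhd-∩ {u = u} {v} {w} u~v uw vw)
adjacent-closedNbhd-∩ {u = false ∷ u} {false ∷ v} {true ∷ w}  u~v (s≤s uw) (s≤s vw) =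
  ⊥-elim (adjacent⇒≢ {u = u} u~v (trans (hamming≤0⇒≡ uw) (sym (hamming≤0⇒≡ {u = v} vw))))
adjacent-closedNbhd-∩ {u = true ∷ u}  {true ∷ v}  {false ∷ w} u~v (s≤s uw) (s≤s vw) =
  ⊥-elim (adjacent⇒≢ {u = u} u~v (trans (hamming≤0⇒≡ uw) (sym (hamming≤0⇒≡ {u = v} vw))))
adjacent-closedNbhd-∩ {u = false ∷ u} {true ∷ v}  {false ∷ w} u~v _ (s≤s vw) =
  inj₁ (cong (false ∷_) (sym (trans (hamming≡0⇒≡ {u = u} (suc-injective u~v)) (hamming≤0⇒≡ vw))))
adjacent-closedNbhd-∩ {u = true ∷ u}  {false ∷ v} {true ∷ w}  u~v _ (s≤s vw) =
  inj₁ (cong (true ∷_) (sym (trans (hamming≡0⇒≡ {u = u} (suc-injective u~v)) (hamming≤0⇒≡ vw))))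
adjacent-closedNbhd-∩ {u = false ∷ u} {true ∷ v}  {true ∷ w}  u~v (s≤s uw) _ =
  inj₂ (cong (true ∷_) (sym (trans (sym (hamming≡0⇒≡ {u = u} (suc-injective u~v))) (hamming≤0⇒≡ uw))))
adjacent-closedNbhd-∩ {u = true ∷ u}  {false ∷ v} {false ∷ w} u~v (s≤s uw) _ =
  inj₂ (cong (false ∷_) (sym (trans (sym (hamming≡0⇒≡ {u = u} (suc-injective u~v))) (hamming≤0⇒≡ uw))))

module _ {a} {A : Set a} where

  unique-all-≡⇒length≤1 : ∀ {z : A} {xs} → Unique xs → All (_≡ z) xs → length xs ≤ 1
  unique-all-≡⇒length≤1 {xs = []}        _                  _                = z≤n
  unique-all-≡⇒length≤1 {xs = _ ∷ []}    _                  _                = s≤s z≤n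
  unique-all-≡⇒length≤1 {xs = _ ∷ _ ∷ _} ((x≢y ∷ _) ∷ _) (refl ∷ refl ∷ _) = ⊥-elim (x≢y refl)

  ≢-resolveˡ : ∀ {x y z : A} → x ≢ y → y ≡ x ⊎ y ≡ z → y ≡ z
  ≢-resolveˡ x≢y (inj₁ y≡x) = ⊥-elim (x≢y (sym y≡x))
  ≢-resolveˡ _   (inj₂ y≡z) = y≡z

  unique-all-pair⇒length≤2 : ∀ {u v : A} {xs} → Unique xs →
    All (λ x → x ≡ u ⊎ x ≡ v) xs → length xs ≤ 2
  unique-all-pair⇒length≤2 []         []               = z≤n
  unique-all-pair⇒length≤2 (x∉ ∷ xs!) (inj₁ refl ∷ xs∈) =
    s≤s (unique-all-≡⇒length≤1 xs! (All.zipWith (uncurry ≢-resolveˡ) (x∉ , xs∈)))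
  unique-all-pair⇒length≤2 (x∉ ∷ xs!) (inj₂ refl ∷ xs∈) =
    s≤s (unique-all-≡⇒length≤1 xs! (All.zipWith (uncurry ≢-resolveˡ) (x∉ , All.map Sum.swap xs∈)))

  all-nonempty⇒witness : ∀ {p} {P : A → Set p} {xs} → All P xs → 1 ≤ length xs → Σ A P
  all-nonempty⇒witness (px ∷ _) _ = _ , px

allWords-unique : ∀ n → Unique (allWords n)
allWords-unique 0       = [] ∷ []
allWords-unique (suc n) =
  Unique.++⁺ (Unique.map⁺ ∷-injectiveʳ (allWords-unique n))
             (Unique.map⁺ ∷-injectiveʳ (allWords-unique n))
             λ (∈false , ∈true) → false≢true ∈false ∈true
  where
  false≢true : ∀ {w} → w ∈ map (false ∷_) (allWords n) → ¬ w ∈ map (true ∷_) (allWords n)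
  false≢true ∈false ∈true with ∈-map⁻ (false ∷_) ∈false | ∈-map⁻ (true ∷_) ∈true
  ... | _ , _ , refl | _ , _ , ()

¬T⇒T-not : ∀ {b} → ¬ T b → T (not b)
¬T⇒T-not {false} _  = _
¬T⇒T-not {true}  ¬t = ¬t _

module _ {n} (C : Code n) where

  InI-self : ∀ {c} → T (C c) → InI C c c
  InI-self {c} c∈C = closedNbhd-refl c , c∈C

  cardI≥1⇒InI : ∀ x → 1 ≤ cardI C x → Σ (Word n) (InI C x)
  cardI≥1⇒InI x = all-nonempty⇒witness (all-filter (inI? C x) (allWords n))

  cardI≤2 : ∀ {x u v} → (∀ {w} → InI C x w → w ≡ u ⊎ w ≡ v) → cardI C x ≤ 2
  cardI≤2 {x} I⊆uv = unique-all-pair⇒length≤2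
    (Unique.filter⁺ (inI? C x) (allWords-unique n))
    (All.map I⊆uv (all-filter (inI? C x) (allWords n)))

  SameI-sym : ∀ {u v} → SameI C u v → SameI C v u
  SameI-sym u≈v w = ⇔.sym (u≈v w)

  adjacent-SameI⇒InI⊆pair : ∀ {u v w} → Adjacent u v → SameI C u v →
    InI C u w → w ≡ u ⊎ w ≡ v
  adjacent-SameI⇒InI⊆pair u~v u≈v w∈ =
    adjacent-closedNbhd-∩ u~v (proj₁ w∈) (proj₁ (Equivalence.to (u≈v _) w∈))

  adjacent-SameI⇒cardI≤2 : ∀ {u v} → Adjacent u v → SameI C u v → cardI C u ≤ 2
  adjacent-SameI⇒cardI≤2 {u} {v} u~v u≈v = cardI≤2 {u} (adjacent-SameI⇒InI⊆pair {u} {v} u~v u≈v)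

mainTheorem8 : (n : ℕ) → 1 ≤ n → (C : Code n) → Nonempty C →
    ((c : Word n) → T (C c) → 3 ≤ cardI C c) →
    ((x : Word n) → T (not (C x)) → 1 ≤ cardI C x) →
    IsLocalIdentifying C
mainTheorem8 n _ C _ C⇒3≤cardI ∁C⇒1≤cardI = covering , separating
  where
  covering : IsCovering C
  covering u with T? (C u)
  ... | yes u∈C = u , InI-self C u∈C
  ... | no  u∉C = cardI≥1⇒InI C u (∁C⇒1≤cardI u (¬T⇒T-not u∉C))

  twin∉C : ∀ {u v} → Adjacent u v → SameI C u v → ¬ T (C u)
  twin∉C {u} {v} u~v u≈v u∈C = ≤⇒≯ (adjacent-SameI⇒cardI≤2 C {u} {v} u~v u≈v) (C⇒3≤cardI u u∈C)

  separating : (u v : Word n) → Adjacent u v → ¬ SameI C u v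
  separating u v u~v u≈v
    with w , w∈ ← covering u
    with adjacent-SameI⇒InI⊆pair C {u} {v} u~v u≈v w∈
  ... | inj₁ refl = twin∉C u~v u≈v (proj₂ w∈)
  ... | inj₂ refl = twin∉C {v} {u} (adjacent-sym {u = u} u~v) (SameI-sym C {u} {v} u≈v) (proj₂ w∈)
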